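{- Let $q\ge2$, $\tilde n,k,\tilde d,u\ge1$ and $e\ge0$ be integers, and let $\mathcal{C}\subseteq[q]^{\tilde n}$ be a code with $q^k$ codewords and minimum Hamming distance at least $\tilde d$. Let $\varphi\colon[q]\to\{0,1\}^{q^u}$ map $x$ to the vector, with coordinates indexed by $[q]^u$, that has a $1$ at position $(a_1,\dots,a_u)$ iff $a_i=x$ for some $i\in[u]$. Let $M'$ be the $\tilde n\times q^k$ matrix over $[q]$ whose columns are the codewords of $\mathcal{C}$, and let $M$ be the $(\tilde nq^u)\times q^k$ Boolean matrix obtained by replacing each entry $x$ of $M'$ by the column vector $\varphi(x)$. Then $M$ is strongly $(d,e;u)$-disjunct for every integer $d$ with $d<(\tilde n-e)/((\tilde n-\tilde d)u)$.
   Context: With $\mathrm{supp}(C)$ the set of row indices where a Boolean column $C$ is $1$, a matrix with at least $d+u$ columns is strongly $(d,e;u)$-disjunct if for every choice of $d+u$ distinct columns $C_1,\dots,C_u,C'_1,\dots,C'_d$, $|\bigcap_{i=1}^u\mathrm{supp}(C_i)\setminus\bigcup_{i=1}^d\mathrm{supp}(C'_i)|>e$. -}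

module Defs where

open import Data.Nat using (ℕ; _+_; _*_; _^_; _<_)
open import Data.Bool using (Bool; true; false; not)
open import Data.Fin using (Fin; _≟_; _↑ˡ_; _↑ʳ_; remQuot; finToFun)
open import Data.Fin.Subset using (Subset; ⋂; ⋃; _─_; ∣_∣)
open import Data.Vec using (tabulate)
open import Data.List using (List)
import Data.List as List
open import Data.Product using (∃; _,_; proj₁; proj₂)
open import Relation.Nullary.Decidable using (⌊_⌋)
open import Relation.Binary.PropositionalEquality using (_≡_; _≢_)
open import Function.Definitions using (Injective)

BoolMatrix : ℕ → ℕ → Set
BoolMatrix m n = Fin m → Fin n → Bool

supp : ∀ {m n} → BoolMatrix m n → Fin n → Subset m
supp M j = tabulate (λ r → M r j)

-- Strongly (d,e;u)-disjunct: for every choice of d+u distinct columns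
-- C_1..C_u (indices f (i ↑ˡ d)) and C'_1..C'_d (indices f (u ↑ʳ j)),
-- | ⋂ supp(C_i) \ ⋃ supp(C'_j) | > e.
StronglyDisjunct : ∀ {m n} → ℕ → ℕ → ℕ → BoolMatrix m n → Set
StronglyDisjunct {m} {n} d e u M =
  (f : Fin (u + d) → Fin n) → Injective _≡_ _≡_ f →
  e < ∣ ⋂ (List.tabulate (λ (i : Fin u) → supp M (f (i ↑ˡ d))))
        ─ ⋃ (List.tabulate (λ (j : Fin d) → supp M (f (u ↑ʳ j)))) ∣

hamming : ∀ {q n} → (Fin n → Fin q) → (Fin n → Fin q) → ℕ
hamming x y = ∣ tabulate (λ i → not ⌊ x i ≟ y i ⌋) ∣

φ : ∀ {q} (u : ℕ) → Fin q → (Fin u → Fin q) → Bool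
φ {q} u x a = ∣ tabulate (λ i → ⌊ a i ≟ x ⌋) ∣ ≢0
  where
  _≢0 : ℕ → Bool
  ℕ.zero ≢0 = false
  ℕ.suc _ ≢0 = true

-- The concatenated matrix M: rows indexed by Fin (ñ * q^u), row r decoded
-- as (p , a) with p : Fin ñ a position and a ∈ [q]^u (via finToFun);
-- column c is the codeword c, and M[(p,a), c] = φ(codeword c at p)[a].
concatMatrix : ∀ {q ñ N} (u : ℕ) → (Fin N → Fin ñ → Fin q) → BoolMatrix (ñ * q ^ u) N
concatMatrix {q} {ñ} u code r c =
  φ u (code c (proj₁ (remQuot {ñ} (q ^ u) r))) (finToFun (proj₂ (remQuot {ñ} (q ^ u) r)))

-- Fix the u chosen codewords xᵢ and the d other codewords yⱼ. Call a position p
-- a clash if some yⱼ agrees with some xᵢ at p. Two distinct codewords agree in at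
-- most ñ − d̃ positions, so at most d·u·(ñ − d̃) positions clash. At a clash-free
-- position p the row (p, (x₁ p, …, x_u p)) of M has a 1 in every column xᵢ and a 0
-- in every column yⱼ, and distinct positions give distinct rows; hence more than e
-- rows lie in ⋂ supp xᵢ ∖ ⋃ supp yⱼ.
module Submission where

open import Defs
open import Data.Nat using (ℕ; zero; suc; _+_; _*_; _^_; _∸_; _<_; _≤_; _≥_; z≤n; s≤s)
open import Data.Nat.Properties
  using (≤-trans; ≤-reflexive; +-monoʳ-≤; +-mono-≤; n≤1+n; +-suc; +-comm; *-comm; ∸-monoʳ-≤;
         m∸[m∸n]≡n; m+n≤o⇒m≤o∸n; <-≤-trans; module ≤-Reasoning)
open import Data.Bool using (Bool; true; false; not)
open import Data.Bool.Properties using (T-≡)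
open import Data.Fin using (Fin; zero; suc; _≟_; _↑ˡ_; _↑ʳ_; combine; funToFin; finToFun)
open import Data.Fin.Properties
  using (suc-injective; 0≢1+n; remQuot-combine; combine-injectiveˡ; finToFun-funToFin)
open import Data.Fin.Subset
open import Data.Fin.Subset.Properties
open import Data.Vec using (_∷_; []; here; there; tabulate)
open import Data.Vec.Properties using (lookup∘tabulate; lookup⇒[]=; []=⇒lookup; tabulate-∘)
import Data.List as List
open import Data.Product using (∃; _,_)
open import Data.Sum using (inj₁; inj₂)
open import Function using (_∘_; Equivalence)
open import Function.Definitions using (Injective)
open import Level using (Level)
open import Relation.Nullary using (contradiction)
open import Relation.Nullary.Decidable using (⌊_⌋; toWitness; fromWitness)
open import Relation.Unary using (Pred; Decidable)
open import Relation.Binary.PropositionalEquality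
  using (_≡_; _≢_; _≗_; refl; sym; trans; cong; subst; module ≡-Reasoning)

private
  variable
    ℓ : Level
    m n q u d : ℕ
    x : Fin n

∣p∪q∣≤∣p∣+∣q∣ : (p r : Subset n) → ∣ p ∪ r ∣ ≤ ∣ p ∣ + ∣ r ∣
∣p∪q∣≤∣p∣+∣q∣ []            []            = z≤n
∣p∪q∣≤∣p∣+∣q∣ (inside  ∷ p) (inside  ∷ r) =
  s≤s (≤-trans (∣p∪q∣≤∣p∣+∣q∣ p r) (+-monoʳ-≤ ∣ p ∣ (n≤1+n ∣ r ∣)))
∣p∪q∣≤∣p∣+∣q∣ (inside  ∷ p) (outside ∷ r) = s≤s (∣p∪q∣≤∣p∣+∣q∣ p r)
∣p∪q∣≤∣p∣+∣q∣ (outside ∷ p) (inside  ∷ r) =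
  subst (suc ∣ p ∪ r ∣ ≤_) (sym (+-suc ∣ p ∣ ∣ r ∣)) (s≤s (∣p∪q∣≤∣p∣+∣q∣ p r))
∣p∪q∣≤∣p∣+∣q∣ (outside ∷ p) (outside ∷ r) = ∣p∪q∣≤∣p∣+∣q∣ p r

∣⋃∣≤m*c : ∀ {c} (P : Fin m → Subset n) → (∀ i → ∣ P i ∣ ≤ c) →
          ∣ ⋃ (List.tabulate P) ∣ ≤ m * c
∣⋃∣≤m*c {zero}  {n} P _     = ≤-reflexive (∣⊥∣≡0 n)
∣⋃∣≤m*c {suc m}     P ∣P∣≤c =
  ≤-trans (∣p∪q∣≤∣p∣+∣q∣ (P zero) _) (+-mono-≤ (∣P∣≤c zero) (∣⋃∣≤m*c (P ∘ suc) (∣P∣≤c ∘ suc)))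

-- Removing f zero from r leaves room for the image of the rest of p.
injective⇒∣p∣≤∣q∣ : ∀ {f : Fin n → Fin m} → Injective _≡_ _≡_ f →
                    (p : Subset n) (r : Subset m) → (∀ {x} → x ∈ p → f x ∈ r) → ∣ p ∣ ≤ ∣ r ∣
injective⇒∣p∣≤∣q∣ f-inj []            r _       = z≤n
injective⇒∣p∣≤∣q∣ f-inj (outside ∷ p) r f[p]⊆r =
  injective⇒∣p∣≤∣q∣ (suc-injective ∘ f-inj) p r (f[p]⊆r ∘ there)
injective⇒∣p∣≤∣q∣ {f = f} f-inj (inside ∷ p) r f[p]⊆r =
  ≤-trans (s≤s ∣p∣≤∣r-f₀∣) (x∈p⇒∣p-x∣<∣p∣ (f[p]⊆r here))
  where
  ∣p∣≤∣r-f₀∣ : ∣ p ∣ ≤ ∣ r - f zero ∣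
  ∣p∣≤∣r-f₀∣ = injective⇒∣p∣≤∣q∣ (suc-injective ∘ f-inj) p (r - f zero)
    (λ x∈p → x∈p∧x≢y⇒x∈p-y (f[p]⊆r (there x∈p)) (λ eq → 0≢1+n (sym (f-inj eq))))

∈-tabulate⁺ : ∀ {f : Fin n → Bool} → f x ≡ true → x ∈ tabulate f
∈-tabulate⁺ {x = x} {f} fx≡true = lookup⇒[]= x (tabulate f) (trans (lookup∘tabulate f x) fx≡true)

∈-tabulate⁻ : ∀ {f : Fin n → Bool} → x ∈ tabulate f → f x ≡ true
∈-tabulate⁻ {x = x} {f} x∈ = trans (sym (lookup∘tabulate f x)) ([]=⇒lookup x∈)

∈-tabulate-⌊⌋⁺ : ∀ {P : Pred (Fin n) ℓ} (P? : Decidable P) → P x → x ∈ tabulate (λ y → ⌊ P? y ⌋)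
∈-tabulate-⌊⌋⁺ {x = x} P? px = ∈-tabulate⁺ (Equivalence.to T-≡ (fromWitness {a? = P? x} px))

∈-tabulate-⌊⌋⁻ : ∀ {P : Pred (Fin n) ℓ} (P? : Decidable P) → x ∈ tabulate (λ y → ⌊ P? y ⌋) → P x
∈-tabulate-⌊⌋⁻ {x = x} P? x∈ = toWitness {a? = P? x} (Equivalence.from T-≡ (∈-tabulate⁻ x∈))

∈-⋂⁺ : ∀ {P : Fin m → Subset n} → (∀ i → x ∈ P i) → x ∈ ⋂ (List.tabulate P)
∈-⋂⁺ {zero}  _     = ∈⊤
∈-⋂⁺ {suc m} x∈P = x∈p∩q⁺ (x∈P zero , ∈-⋂⁺ (x∈P ∘ suc))

∈-⋃⁺ : ∀ {P : Fin m → Subset n} (i : Fin m) → x ∈ P i → x ∈ ⋃ (List.tabulate P)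
∈-⋃⁺ zero    x∈Pᵢ = x∈p∪q⁺ (inj₁ x∈Pᵢ)
∈-⋃⁺ (suc i) x∈Pᵢ = x∈p∪q⁺ (inj₂ (∈-⋃⁺ i x∈Pᵢ))

∈-⋃⁻ : ∀ (P : Fin m → Subset n) → x ∈ ⋃ (List.tabulate P) → ∃ λ i → x ∈ P i
∈-⋃⁻ {zero}  P x∈⊥ = contradiction x∈⊥ ∉⊥
∈-⋃⁻ {suc m} P x∈⋃ with x∈p∪q⁻ (P zero) _ x∈⋃
... | inj₁ x∈P₀ = zero , x∈P₀
... | inj₂ x∈⋃′ = let i , x∈Pᵢ = ∈-⋃⁻ (P ∘ suc) x∈⋃′ in suc i , x∈Pᵢ

↑ʳ≢↑ˡ : ∀ (j : Fin d) (i : Fin u) → u ↑ʳ j ≢ i ↑ˡ d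
↑ʳ≢↑ˡ j zero    ()
↑ʳ≢↑ˡ j (suc i) eq = ↑ʳ≢↑ˡ j i (suc-injective eq)

agreement : (Fin n → Fin q) → (Fin n → Fin q) → Subset n
agreement x y = tabulate (λ p → ⌊ x p ≟ y p ⌋)

∣agreement∣≡n∸hamming : (x y : Fin n → Fin q) → ∣ agreement x y ∣ ≡ n ∸ hamming x y
∣agreement∣≡n∸hamming {n} x y = begin
  ∣ A ∣             ≡⟨ m∸[m∸n]≡n (∣p∣≤n A) ⟨
  n ∸ (n ∸ ∣ A ∣)   ≡⟨ cong (n ∸_) (∣∁p∣≡n∸∣p∣ A) ⟨
  n ∸ ∣ ∁ A ∣       ≡⟨ cong (λ s → n ∸ ∣ s ∣) (tabulate-∘ not (λ p → ⌊ x p ≟ y p ⌋)) ⟨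
  n ∸ hamming x y   ∎
  where
  open ≡-Reasoning
  A = agreement x y

clashes : (Fin u → Fin n → Fin q) → (Fin d → Fin n → Fin q) → Subset n
clashes xs ys = ⋃ (List.tabulate λ j → ⋃ (List.tabulate λ i → agreement (ys j) (xs i)))

∣clashes∣≤d*[t*u] : ∀ {t} (xs : Fin u → Fin n → Fin q) (ys : Fin d → Fin n → Fin q) →
                    (∀ i j → ∣ agreement (ys j) (xs i) ∣ ≤ t) → ∣ clashes xs ys ∣ ≤ d * (t * u)
∣clashes∣≤d*[t*u] {u} {t = t} xs ys ∣agreement∣≤t = ∣⋃∣≤m*c _ λ j →
  subst (∣ ⋃ (List.tabulate λ i → agreement (ys j) (xs i)) ∣ ≤_) (*-comm u t)
        (∣⋃∣≤m*c _ λ i → ∣agreement∣≤t i j)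

∉clashes⇒≢ : ∀ {xs : Fin u → Fin n → Fin q} {ys : Fin d → Fin n → Fin q} {p} →
             p ∉ clashes xs ys → ∀ i j → ys j p ≢ xs i p
∉clashes⇒≢ {xs = xs} {ys} {p} p∉ i j eq =
  p∉ (∈-⋃⁺ j (∈-⋃⁺ i (∈-tabulate-⌊⌋⁺ (λ p → ys j p ≟ xs i p) eq)))

φ-hit : ∀ {x : Fin q} {a : Fin u → Fin q} (i : Fin u) → a i ≡ x → φ u x a ≡ true
φ-hit {x = x} {a} i aᵢ≡x with ∣ tabulate (λ i → ⌊ a i ≟ x ⌋) ∣
                           | ≤-trans (s≤s z≤n) (x∈p⇒∣p-x∣<∣p∣ (∈-tabulate-⌊⌋⁺ (λ i → a i ≟ x) aᵢ≡x))
... | suc _ | _ = refl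

φ-miss : ∀ {x : Fin q} {a : Fin u → Fin q} → (∀ i → a i ≢ x) → φ u x a ≡ false
φ-miss {u = u} {x = x} {a} a≢x with ∣ tabulate (λ i → ⌊ a i ≟ x ⌋) ∣ in ∣hits∣≡
... | zero = refl
... | suc _ = contradiction (trans (sym ∣hits∣≡) (trans (cong ∣_∣ hits≡⊥) (∣⊥∣≡0 u))) λ ()
  where
  hits≡⊥ : tabulate (λ i → ⌊ a i ≟ x ⌋) ≡ ⊥
  hits≡⊥ = Empty-unique λ (i , i∈hits) → a≢x i (∈-tabulate-⌊⌋⁻ (λ i → a i ≟ x) i∈hits)

module _ (u : ℕ) {N ñ : ℕ} (code : Fin N → Fin ñ → Fin q) where

  private
    M : BoolMatrix (ñ * q ^ u) N
    M = concatMatrix u code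

  concatMatrix-combine : ∀ p a c → M (combine p a) c ≡ φ u (code c p) (finToFun a)
  concatMatrix-combine p a c =
    cong (λ (p′ , a′) → φ u (code c p′) (finToFun a′)) (remQuot-combine {ñ} {q ^ u} p a)

  row : (Fin u → Fin N) → Fin ñ → Fin (ñ * q ^ u)
  row xs p = combine p (funToFin (λ i → code (xs i) p))

  row-injective : ∀ xs → Injective _≡_ _≡_ (row xs)
  row-injective xs {p} {p′} = combine-injectiveˡ p _ p′ _

  row∈⋂─⋃ : ∀ (xs : Fin u → Fin N) (ys : Fin d → Fin N) {p} →
            p ∉ clashes (code ∘ xs) (code ∘ ys) →
            row xs p ∈ ⋂ (List.tabulate (supp M ∘ xs)) ─ ⋃ (List.tabulate (supp M ∘ ys))
  row∈⋂─⋃ xs ys {p} p∉ = x∈p∧x∉q⇒x∈p─q (∈-⋂⁺ row∈xs) row∉ys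
    where
    letters : finToFun (funToFin (λ i → code (xs i) p)) ≗ (λ i → code (xs i) p)
    letters = finToFun-funToFin (λ i → code (xs i) p)

    row∈xs : ∀ i → row xs p ∈ supp M (xs i)
    row∈xs i = ∈-tabulate⁺ (trans (concatMatrix-combine p _ (xs i)) (φ-hit i (letters i)))

    row∉ys : row xs p ∉ ⋃ (List.tabulate (supp M ∘ ys))
    row∉ys row∈ with j , row∈yⱼ ← ∈-⋃⁻ (supp M ∘ ys) row∈ =
      contradiction (trans (sym (∈-tabulate⁻ row∈yⱼ)) (trans (concatMatrix-combine p _ (ys j))
                      (φ-miss λ i eq → ∉clashes⇒≢ p∉ i j (trans (sym eq) (letters i)))))
                    λ ()

  ∣⋂─⋃∣≥ñ∸d*[t*u] : ∀ {t} (xs : Fin u → Fin N) (ys : Fin d → Fin N) →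
                    (∀ i j → ∣ agreement (code (ys j)) (code (xs i)) ∣ ≤ t) →
                    ñ ∸ d * (t * u) ≤ ∣ ⋂ (List.tabulate (supp M ∘ xs)) ─ ⋃ (List.tabulate (supp M ∘ ys)) ∣
  ∣⋂─⋃∣≥ñ∸d*[t*u] {d} {t} xs ys ∣agreement∣≤t = begin
    ñ ∸ d * (t * u)   ≤⟨ ∸-monoʳ-≤ ñ (∣clashes∣≤d*[t*u] (code ∘ xs) (code ∘ ys) ∣agreement∣≤t) ⟩
    ñ ∸ ∣ C ∣         ≡⟨ ∣∁p∣≡n∸∣p∣ C ⟨
    ∣ ∁ C ∣           ≤⟨ injective⇒∣p∣≤∣q∣ (row-injective xs) (∁ C) _ (row∈⋂─⋃ xs ys ∘ x∈∁p⇒x∉p) ⟩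
    ∣ ⋂ (List.tabulate (supp M ∘ xs)) ─ ⋃ (List.tabulate (supp M ∘ ys)) ∣ ∎
    where
    open ≤-Reasoning
    C = clashes (code ∘ xs) (code ∘ ys)

lemma18 : (q ñ k d̃ u e : ℕ) → q ≥ 2 → ñ ≥ 1 → k ≥ 1 → d̃ ≥ 1 → u ≥ 1 →
          (code : Fin (q ^ k) → Fin ñ → Fin q) →
          (∀ i j → i ≢ j → d̃ ≤ hamming (code i) (code j)) →
          (d : ℕ) → d * ((ñ ∸ d̃) * u) + e < ñ →
          StronglyDisjunct d e u (concatMatrix u code)
lemma18 q ñ k d̃ u e _ _ _ _ _ code dist d bound f f-inj =
  <-≤-trans e<ñ∸d*[t*u] (∣⋂─⋃∣≥ñ∸d*[t*u] u code (f ∘ (_↑ˡ d)) (f ∘ (u ↑ʳ_)) ∣agreement∣≤t)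
  where
  t : ℕ
  t = ñ ∸ d̃

  ∣agreement∣≤t : ∀ i j → ∣ agreement (code (f (u ↑ʳ j))) (code (f (i ↑ˡ d))) ∣ ≤ t
  ∣agreement∣≤t i j =
    subst (_≤ t) (sym (∣agreement∣≡n∸hamming (code (f (u ↑ʳ j))) (code (f (i ↑ˡ d)))))
          (∸-monoʳ-≤ ñ (dist _ _ (↑ʳ≢↑ˡ j i ∘ f-inj)))

  e<ñ∸d*[t*u] : e < ñ ∸ d * (t * u)
  e<ñ∸d*[t*u] = m+n≤o⇒m≤o∸n (suc e) (subst (_≤ ñ) (cong suc (+-comm (d * (t * u)) e)) bound)
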